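{- Let $M=\langle W,\mathcal{N},\leq,V\rangle$ be the canonical model for $\mathbf{WWW}$, where $n_w=\{\widehat{\varphi}:\mathsf{W}\varphi\in w\}$ and $\mathcal{N}_w=\{X\subseteq W:\text{there is }Y\in n_w\text{ with }Y\subseteq X\}$. Then for every formula $\gamma$ and every $w\in W$: $w\Vdash\gamma$ iff $\gamma\in w$.
   Context: Formulas are built from a countable set $PV$ of propositional variables and $\bot$ by $\land,\lor,\rightarrow$ and a unary modal operator $\mathsf{W}$; $\lnot\varphi$ abbreviates $\varphi\to\bot$, $\varphi\leftrightarrow\psi$ abbreviates $(\varphi\to\psi)\land(\psi\to\varphi)$. The logic $\mathbf{WWW}$ is the smallest set of formulas containing all instances of the axiom schemes of intuitionistic propositional logic and all instances of $\mathsf{W}\varphi\to\lnot\varphi$, closed under modus ponens, the rule "from $\varphi\leftrightarrow\psi$ infer $\mathsf{W}\varphi\leftrightarrow\mathsf{W}\psi$", and the rule "from $\varphi\to\psi$ infer $(\mathsf{W}\varphi\land\lnot\psi)\to\mathsf{W}\psi$". A prime theory of $\mathbf{WWW}$ is a set $w$ of formulas with $\mathbf{WWW}\subseteq w$, closed under modus ponens, $\bot\notin w$, and $\varphi\lor\psi\in w$ implies $\varphi\in w$ or $\psi\in w$. The canonical model: $W$ = all prime theories of $\mathbf{WWW}$, $w\leq v$ iff $w\subseteq v$, $V(q)=\{w:q\in w\}$, $\widehat{\varphi}=\{z\in W:\varphi\in z\}$. Forcing: $w\nVdash\bot$; $w\Vdash q$ iff $w\in V(q)$; $\land,\lor$ pointwise;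 $w\Vdash\varphi\to\psi$ iff for all $v\geq w$, $v\nVdash\varphi$ or $v\Vdash\psi$; $w\Vdash\mathsf{W}\varphi$ iff $w\Vdash\lnot\varphi$ and $V(\varphi)\in\mathcal{N}_w$, where $V(\varphi)=\{z:z\Vdash\varphi\}$. -}

module Defs where

open import Level using (Level; 0ℓ; Lift) renaming (suc to lsuc)
open import Data.Nat using (ℕ)
open import Data.Empty using (⊥)
open import Data.Product using (Σ; _×_)
open import Data.Sum using (_⊎_)
open import Relation.Nullary using (¬_)

infixr 6 _∧_
infixr 5 _∨_
infixr 4 _⇒_

data Form : Set where
  var : ℕ → Form
  ⊥'  : Form
  _∧_ : Form → Form → Form
  _∨_ : Form → Form → Form
  _⇒_ : Form → Form → Form
  𝖶   : Form → Form

¬' : Form → Form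
¬' φ = φ ⇒ ⊥'

_⇔'_ : Form → Form → Form
φ ⇔' ψ = (φ ⇒ ψ) ∧ (ψ ⇒ φ)

data WWW : Form → Set where
  ax-K   : ∀ φ ψ → WWW (φ ⇒ (ψ ⇒ φ))
  ax-S   : ∀ φ ψ χ → WWW ((φ ⇒ (ψ ⇒ χ)) ⇒ ((φ ⇒ ψ) ⇒ (φ ⇒ χ)))
  ax-∧E₁ : ∀ φ ψ → WWW ((φ ∧ ψ) ⇒ φ)
  ax-∧E₂ : ∀ φ ψ → WWW ((φ ∧ ψ) ⇒ ψ)
  ax-∧I  : ∀ φ ψ → WWW (φ ⇒ (ψ ⇒ (φ ∧ ψ)))
  ax-∨I₁ : ∀ φ ψ → WWW (φ ⇒ (φ ∨ ψ))
  ax-∨I₂ : ∀ φ ψ → WWW (ψ ⇒ (φ ∨ ψ))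
  ax-∨E  : ∀ φ ψ χ → WWW ((φ ⇒ χ) ⇒ ((ψ ⇒ χ) ⇒ ((φ ∨ ψ) ⇒ χ)))
  ax-⊥E  : ∀ φ → WWW (⊥' ⇒ φ)
  ax-W   : ∀ φ → WWW (𝖶 φ ⇒ ¬' φ)
  mp     : ∀ {φ ψ} → WWW (φ ⇒ ψ) → WWW φ → WWW ψ
  rule-RE : ∀ {φ ψ} → WWW (φ ⇔' ψ) → WWW (𝖶 φ ⇔' 𝖶 ψ)
  rule-W  : ∀ {φ ψ} → WWW (φ ⇒ ψ) → WWW ((𝖶 φ ∧ ¬' ψ) ⇒ 𝖶 ψ)

record PrimeTheory : Set₁ where
  field
    mem        : Form → Set
    has-WWW    : ∀ {φ} → WWW φ → mem φ
    closed-mp  : ∀ {φ ψ} → mem (φ ⇒ ψ) → mem φ → mem ψ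
    consistent : ¬ mem ⊥'
    prime      : ∀ {φ ψ} → mem (φ ∨ ψ) → mem φ ⊎ mem ψ
open PrimeTheory public

World : Set₁
World = PrimeTheory

_≤w_ : World → World → Set
w ≤w v = ∀ φ → mem w φ → mem v φ

hat : Form → World → Set₁
hat φ z = Lift (lsuc 0ℓ) (mem z φ)

-- n_w = { φ-hat : W φ ∈ w };
-- X ∈ N_w iff there is Y ∈ n_w with Y ⊆ X, i.e. (unfolded)
-- there is φ with W φ ∈ w and φ-hat ⊆ X.
Nbhd : World → (World → Set₁) → Set₁
Nbhd w X = Σ Form λ φ → mem w (𝖶 φ) × (∀ z → hat φ z → X z)

-- V(q) = { w : q ∈ w }
infix 3 _⊩_
_⊩_ : World → Form → Set₁
w ⊩ var q = Lift (lsuc 0ℓ) (mem w (var q))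
w ⊩ ⊥' = Lift (lsuc 0ℓ) ⊥
w ⊩ (φ ∧ ψ) = (w ⊩ φ) × (w ⊩ ψ)
w ⊩ (φ ∨ ψ) = (w ⊩ φ) ⊎ (w ⊩ ψ)
w ⊩ (φ ⇒ ψ) = ∀ v → w ≤w v → v ⊩ φ → v ⊩ ψ
-- w ⊩ ¬φ is written out: for all v ≥ w, v ⊮ φ (⊥ is never forced)
w ⊩ 𝖶 φ = (∀ v → w ≤w v → v ⊩ φ → Lift (lsuc 0ℓ) ⊥) × Nbhd w (λ z → z ⊩ φ)

-- Derivability from a set of
-- hypotheses satisfies the deduction theorem, and, classically, every set of
-- hypotheses that does not derive ψ extends to a prime theory omitting ψ
-- (Lindenbaum, using an enumeration of the formulas). Hence a formula belongs to
-- every prime theory extending Γ exactly when Γ derives it. The truth lemma is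
-- then an induction on γ: the implication case is this completeness applied to
-- w ∪ {φ}; for W φ, a forced W φ comes with W χ ∈ w and χ̂ ⊆ φ̂, completeness over
-- the empty context turns χ̂ ⊆ φ̂ into ⊢ χ → φ, and the rule
-- (W χ ∧ ¬φ) → W φ concludes.
module Submission where

open import Defs
open import Level using (0ℓ; lift; lower)
open import Axiom.ExcludedMiddle using (ExcludedMiddle)
open import Function.Bundles using (_⇔_; mk⇔)
open import Data.Nat using (ℕ; zero; suc; _+_; _≤_; s≤s; _⊔_; _≤′_; ≤′-refl; ≤′-step)
open import Data.Nat.Properties using (+-suc; +-identityʳ; m≤m⊔n; m≤n⊔m; m⊔n≤o⇒m≤o; m⊔n≤o⇒n≤o; ≤-refl; ≤⇒≤′)
open import Data.Product using (Σ; ∃; _×_; _,_; proj₁; proj₂)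
open import Data.Sum using (_⊎_; inj₁; inj₂)
open import Data.Empty using (⊥-elim)
open import Relation.Nullary using (¬_; yes; no)
open import Relation.Unary using (Pred; _⊆_; ∅; ｛_｝; _∪_; ⋃)
open import Relation.Binary.PropositionalEquality using (_≡_; refl; sym; trans; cong; cong₂)
open Relation.Binary.PropositionalEquality.≡-Reasoning

unpair-step : ℕ × ℕ → ℕ × ℕ
unpair-step (zero  , j) = suc j , 0
unpair-step (suc i , j) = i , suc j

-- unpair runs through each anti-diagonal i + j = d from (d , 0) to (0 , d), then
-- jumps to (d + 1 , 0); diagonal d is the position of (d , 0).
unpair : ℕ → ℕ × ℕ
unpair zero    = 0 , 0
unpair (suc n) = unpair-step (unpair n)

unpair-walk : ∀ k i j n → unpair n ≡ (k + i , j) → unpair (k + n) ≡ (i , j + k)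
unpair-walk zero    i j n eq = trans eq (cong (i ,_) (sym (+-identityʳ j)))
unpair-walk (suc k) i j n eq = begin
  unpair (suc k + n)  ≡⟨ cong unpair (sym (+-suc k n)) ⟩
  unpair (k + suc n)  ≡⟨ unpair-walk k i (suc j) (suc n) (cong unpair-step eq) ⟩
  (i , suc j + k)     ≡⟨ cong (i ,_) (sym (+-suc j k)) ⟩
  (i , j + suc k)     ∎

diagonal : ℕ → ℕ
diagonal zero    = 0
diagonal (suc d) = suc (d + diagonal d)

unpair-diagonal : ∀ d → unpair (diagonal d) ≡ (d , 0)
unpair-diagonal zero    = refl
unpair-diagonal (suc d) = cong unpair-step
  (unpair-walk d 0 0 (diagonal d) (trans (unpair-diagonal d) (cong (_, 0) (sym (+-identityʳ d)))))

pair : ℕ → ℕ → ℕ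
pair i j = j + diagonal (j + i)

unpair-pair : ∀ i j → unpair (pair i j) ≡ (i , j)
unpair-pair i j = unpair-walk j i 0 (diagonal (j + i)) (unpair-diagonal (j + i))

encode : Form → ℕ
encode (var q) = pair 0 q
encode ⊥'      = pair 1 0
encode (φ ∧ ψ) = pair 2 (pair (encode φ) (encode ψ))
encode (φ ∨ ψ) = pair 3 (pair (encode φ) (encode ψ))
encode (φ ⇒ ψ) = pair 4 (pair (encode φ) (encode ψ))
encode (𝖶 φ)   = pair 5 (encode φ)

height : Form → ℕ
height (var q) = 0
height ⊥'      = 0
height (φ ∧ ψ) = suc (height φ ⊔ height ψ)
height (φ ∨ ψ) = suc (height φ ⊔ height ψ)
height (φ ⇒ ψ) = suc (height φ ⊔ height ψ)
height (𝖶 φ)   = suc (height φ)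

decode-binary : (ℕ → Form) → (Form → Form → Form) → ℕ → Form
decode-binary d op m = op (d (proj₁ (unpair m))) (d (proj₂ (unpair m)))

decode-binary-pair : ∀ d op a b → decode-binary d op (pair a b) ≡ op (d a) (d b)
decode-binary-pair d op a b = cong (λ p → op (d (proj₁ p)) (d (proj₂ p))) (unpair-pair a b)

decode-node : (ℕ → Form) → ℕ × ℕ → Form
decode-node d (0 , q) = var q
decode-node d (2 , m) = decode-binary d _∧_ m
decode-node d (3 , m) = decode-binary d _∨_ m
decode-node d (4 , m) = decode-binary d _⇒_ m
decode-node d (5 , m) = 𝖶 (d m)
decode-node d _       = ⊥'

-- The first argument is fuel bounding the height of the result; out of fuel, ⊥' is returned.
decode : ℕ → ℕ → Form
decode zero    n = ⊥'
decode (suc f) n = decode-node (decode f) (unpair n)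

decode-encode-binary : ∀ {f} t op {φ ψ} →
  (∀ m → decode-node (decode f) (t , m) ≡ decode-binary (decode f) op m) →
  decode f (encode φ) ≡ φ → decode f (encode ψ) ≡ ψ →
  decode (suc f) (pair t (pair (encode φ) (encode ψ))) ≡ op φ ψ
decode-encode-binary {f} t op {φ} {ψ} node-binary eφ eψ = begin
  decode-node (decode f) (unpair (pair t m))  ≡⟨ cong (decode-node (decode f)) (unpair-pair t m) ⟩
  decode-node (decode f) (t , m)              ≡⟨ node-binary m ⟩
  decode-binary (decode f) op m               ≡⟨ decode-binary-pair (decode f) op (encode φ) (encode ψ) ⟩
  op (decode f (encode φ)) (decode f (encode ψ))  ≡⟨ cong₂ op eφ eψ ⟩
  op φ ψ  ∎
  where m = pair (encode φ) (encode ψ)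

decode-encode : ∀ φ {f} → height φ ≤ f → decode (suc f) (encode φ) ≡ φ
decode-encode (var q) {f} _ = cong (decode-node (decode f)) (unpair-pair 0 q)
decode-encode ⊥'      {f} _ = cong (decode-node (decode f)) (unpair-pair 1 0)
decode-encode (φ ∧ ψ) {suc f} (s≤s h) = decode-encode-binary {suc f} 2 _∧_ (λ _ → refl)
  (decode-encode φ (m⊔n≤o⇒m≤o _ _ h)) (decode-encode ψ (m⊔n≤o⇒n≤o _ _ h))
decode-encode (φ ∨ ψ) {suc f} (s≤s h) = decode-encode-binary {suc f} 3 _∨_ (λ _ → refl)
  (decode-encode φ (m⊔n≤o⇒m≤o _ _ h)) (decode-encode ψ (m⊔n≤o⇒n≤o _ _ h))
decode-encode (φ ⇒ ψ) {suc f} (s≤s h) = decode-encode-binary {suc f} 4 _⇒_ (λ _ → refl)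
  (decode-encode φ (m⊔n≤o⇒m≤o _ _ h)) (decode-encode ψ (m⊔n≤o⇒n≤o _ _ h))
decode-encode (𝖶 φ) {suc f} (s≤s h) = begin
  decode-node (decode (suc f)) (unpair (pair 5 (encode φ)))  ≡⟨ cong (decode-node _) (unpair-pair 5 (encode φ)) ⟩
  𝖶 (decode (suc f) (encode φ))                              ≡⟨ cong 𝖶 (decode-encode φ h) ⟩
  𝖶 φ  ∎

enum : ℕ → Form
enum n = decode (proj₁ (unpair n)) (proj₂ (unpair n))

enum-surjective : ∀ φ → ∃ λ n → enum n ≡ φ
enum-surjective φ = pair (suc (height φ)) (encode φ) , (begin
  enum (pair (suc (height φ)) (encode φ))
    ≡⟨ cong (λ p → decode (proj₁ p) (proj₂ p)) (unpair-pair (suc (height φ)) (encode φ)) ⟩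
  decode (suc (height φ)) (encode φ)  ≡⟨ decode-encode φ ≤-refl ⟩
  φ  ∎)

infix 3.5 _⊢_

data _⊢_ (Γ : Pred Form 0ℓ) : Form → Set where
  hyp  : ∀ {φ} → Γ φ → Γ ⊢ φ
  thm  : ∀ {φ} → WWW φ → Γ ⊢ φ
  mp⊢  : ∀ {φ ψ} → Γ ⊢ φ ⇒ ψ → Γ ⊢ φ → Γ ⊢ ψ

⊢-mono : ∀ {Γ Δ φ} → Γ ⊆ Δ → Γ ⊢ φ → Δ ⊢ φ
⊢-mono Γ⊆Δ (hyp x)   = hyp (Γ⊆Δ x)
⊢-mono Γ⊆Δ (thm x)   = thm x
⊢-mono Γ⊆Δ (mp⊢ d e) = mp⊢ (⊢-mono Γ⊆Δ d) (⊢-mono Γ⊆Δ e)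

WWW-refl : ∀ φ → WWW (φ ⇒ φ)
WWW-refl φ = mp (mp (ax-S φ (φ ⇒ φ) φ) (ax-K φ (φ ⇒ φ))) (ax-K φ φ)

deduction : ∀ {Γ φ ψ} → Γ ∪ ｛ φ ｝ ⊢ ψ → Γ ⊢ φ ⇒ ψ
deduction {φ = φ} (hyp (inj₁ x))    = mp⊢ (thm (ax-K _ φ)) (hyp x)
deduction {φ = φ} (hyp (inj₂ refl)) = thm (WWW-refl φ)
deduction {φ = φ} (thm x)           = mp⊢ (thm (ax-K _ φ)) (thm x)
deduction {φ = φ} (mp⊢ d e)         = mp⊢ (mp⊢ (thm (ax-S φ _ _)) (deduction d)) (deduction e)

∅⊢⇒WWW : ∀ {φ} → ∅ ⊢ φ → WWW φ
∅⊢⇒WWW (thm x)   = x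
∅⊢⇒WWW (mp⊢ d e) = mp (∅⊢⇒WWW d) (∅⊢⇒WWW e)

⊢-closed : (w : World) → ∀ {φ} → mem w ⊢ φ → mem w φ
⊢-closed w (hyp x)   = x
⊢-closed w (thm x)   = has-WWW w x
⊢-closed w (mp⊢ d e) = closed-mp w (⊢-closed w d) (⊢-closed w e)

module PrimeExtension (lem : ExcludedMiddle 0ℓ) (Γ : Pred Form 0ℓ) (ψ : Form) (Γ⊬ψ : ¬ Γ ⊢ ψ) where

  stage : ℕ → Pred Form 0ℓ
  stage zero    = Γ
  stage (suc n) = stage n ∪ (λ θ → enum n ≡ θ × ¬ stage n ∪ ｛ enum n ｝ ⊢ ψ)

  limit : Pred Form 0ℓ
  limit = ⋃ ℕ stage

  stage-mono : ∀ {m n} → m ≤ n → stage m ⊆ stage n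
  stage-mono m≤n = go (≤⇒≤′ m≤n)
    where
      go : ∀ {m n} → m ≤′ n → stage m ⊆ stage n
      go ≤′-refl       x = x
      go (≤′-step m≤n) x = inj₁ (go m≤n x)

  stage-⊬ : ∀ n → ¬ stage n ⊢ ψ
  stage-⊬ zero    d = Γ⊬ψ d
  stage-⊬ (suc n) d = stage-⊬ n (⊢-mono (nothing-added (⊢-mono added-is-enum d)) d)
    where
      added-is-enum : stage (suc n) ⊆ stage n ∪ ｛ enum n ｝
      added-is-enum (inj₁ x)        = inj₁ x
      added-is-enum (inj₂ (eq , _)) = inj₂ eq

      nothing-added : stage n ∪ ｛ enum n ｝ ⊢ ψ → stage (suc n) ⊆ stage n
      nothing-added _ (inj₁ x)        = x
      nothing-added d (inj₂ (_ , ¬d)) = ⊥-elim (¬d d)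

  limit-compact : ∀ {θ} → limit ⊢ θ → ∃ λ n → stage n ⊢ θ
  limit-compact (hyp (n , x)) = n , hyp x
  limit-compact (thm x)       = 0 , thm x
  limit-compact (mp⊢ d e) with limit-compact d | limit-compact e
  ... | m , d′ | n , e′ = m ⊔ n , mp⊢ (⊢-mono (stage-mono (m≤m⊔n m n)) d′)
                                      (⊢-mono (stage-mono (m≤n⊔m m n)) e′)

  limit-⊬ : ¬ limit ⊢ ψ
  limit-⊬ d = let n , d′ = limit-compact d in stage-⊬ n d′

  admitted-or-refuted : ∀ θ → limit θ ⊎ limit ∪ ｛ θ ｝ ⊢ ψ
  admitted-or-refuted θ with enum-surjective θ
  ... | n , refl with lem {stage n ∪ ｛ enum n ｝ ⊢ ψ}
  ...   | no ¬d = inj₁ (suc n , inj₂ (refl , ¬d))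
  ...   | yes d = inj₂ (⊢-mono (λ { (inj₁ x) → inj₁ (n , x) ; (inj₂ eq) → inj₂ eq }) d)

  limit-closed : ∀ {θ} → limit ⊢ θ → limit θ
  limit-closed {θ} d with admitted-or-refuted θ
  ... | inj₁ x = x
  ... | inj₂ r = ⊥-elim (limit-⊬ (mp⊢ (deduction r) d))

  limit-prime : ∀ {a b} → limit (a ∨ b) → limit a ⊎ limit b
  limit-prime {a} {b} a∨b with admitted-or-refuted a | admitted-or-refuted b
  ... | inj₁ x | _      = inj₁ x
  ... | inj₂ _ | inj₁ y = inj₂ y
  ... | inj₂ r | inj₂ s =
    ⊥-elim (limit-⊬ (mp⊢ (mp⊢ (mp⊢ (thm (ax-∨E a b ψ)) (deduction r)) (deduction s)) (hyp a∨b)))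

  world : World
  world = record
    { mem        = limit
    ; has-WWW    = λ x → limit-closed (thm x)
    ; closed-mp  = λ x y → limit-closed (mp⊢ (hyp x) (hyp y))
    ; consistent = λ x → limit-⊬ (mp⊢ (thm (ax-⊥E ψ)) (hyp x))
    ; prime      = limit-prime
    }

module Completeness (lem : ExcludedMiddle 0ℓ) where

  prime-extension : ∀ {Γ ψ} → ¬ Γ ⊢ ψ → Σ World λ v → Γ ⊆ mem v × ¬ mem v ψ
  prime-extension {Γ} {ψ} Γ⊬ψ = world , (λ x → 0 , x) , (λ x → limit-⊬ (hyp x))
    where open PrimeExtension lem Γ ψ Γ⊬ψ

  ⊢-complete : ∀ {Γ ψ} → (∀ v → Γ ⊆ mem v → mem v ψ) → Γ ⊢ ψ
  ⊢-complete {Γ} {ψ} h with lem {Γ ⊢ ψ}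
  ... | yes d = d
  ... | no Γ⊬ψ = let v , Γ⊆v , ψ∉v = prime-extension Γ⊬ψ in ⊥-elim (ψ∉v (h v Γ⊆v))

  ⇒-∈-complete : (w : World) → ∀ {φ ψ} → (∀ v → w ≤w v → mem v φ → mem v ψ) → mem w (φ ⇒ ψ)
  ⇒-∈-complete w h = ⊢-closed w (deduction (⊢-complete λ v w∪φ⊆v →
    h v (λ _ x → w∪φ⊆v (inj₁ x)) (w∪φ⊆v (inj₂ refl))))

  ⇒-WWW-complete : ∀ {φ ψ} → (∀ v → mem v φ → mem v ψ) → WWW (φ ⇒ ψ)
  ⇒-WWW-complete h = ∅⊢⇒WWW (deduction (⊢-complete λ v φ⊆v → h v (φ⊆v (inj₂ refl))))

module TruthLemma (lem : ExcludedMiddle 0ℓ) where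
  open Completeness lem

  mp-WWW : ∀ {φ ψ} (w : World) → WWW (φ ⇒ ψ) → mem w φ → mem w ψ
  mp-WWW w ax x = closed-mp w (has-WWW w ax) x

  ∈-∧ : ∀ {φ ψ} (w : World) → mem w φ → mem w ψ → mem w (φ ∧ ψ)
  ∈-∧ w x y = closed-mp w (mp-WWW w (ax-∧I _ _) x) y

  mutual
    ⊩⇒∈ : ∀ γ {w} → w ⊩ γ → mem w γ
    ⊩⇒∈ (var q) x = lower x
    ⊩⇒∈ ⊥' (lift ())
    ⊩⇒∈ (φ ∧ ψ) {w} (x , y) = ∈-∧ w (⊩⇒∈ φ x) (⊩⇒∈ ψ y)
    ⊩⇒∈ (φ ∨ ψ) {w} (inj₁ x) = mp-WWW w (ax-∨I₁ φ ψ) (⊩⇒∈ φ x)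
    ⊩⇒∈ (φ ∨ ψ) {w} (inj₂ y) = mp-WWW w (ax-∨I₂ φ ψ) (⊩⇒∈ ψ y)
    ⊩⇒∈ (φ ⇒ ψ) {w} f = ⇒-∈-complete w λ v w≤v x → ⊩⇒∈ ψ (f v w≤v (∈⇒⊩ φ x))
    ⊩⇒∈ (𝖶 φ) {w} (not-φ , χ , Wχ∈w , χ̂⊆φ̂) = mp-WWW w (rule-W χ⇒φ) (∈-∧ w Wχ∈w ¬φ∈w)
      where
        ¬φ∈w : mem w (¬' φ)
        ¬φ∈w = ⇒-∈-complete w λ v w≤v x → ⊥-elim (lower (not-φ v w≤v (∈⇒⊩ φ x)))

        χ⇒φ : WWW (χ ⇒ φ)
        χ⇒φ = ⇒-WWW-complete λ z x → ⊩⇒∈ φ (χ̂⊆φ̂ z (lift x))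

    ∈⇒⊩ : ∀ γ {w} → mem w γ → w ⊩ γ
    ∈⇒⊩ (var q) x = lift x
    ∈⇒⊩ ⊥' {w} x = ⊥-elim (consistent w x)
    ∈⇒⊩ (φ ∧ ψ) {w} x = ∈⇒⊩ φ (mp-WWW w (ax-∧E₁ φ ψ) x) , ∈⇒⊩ ψ (mp-WWW w (ax-∧E₂ φ ψ) x)
    ∈⇒⊩ (φ ∨ ψ) {w} x with prime w x
    ... | inj₁ y = inj₁ (∈⇒⊩ φ y)
    ... | inj₂ z = inj₂ (∈⇒⊩ ψ z)
    ∈⇒⊩ (φ ⇒ ψ) x v w≤v y = ∈⇒⊩ ψ (closed-mp v (w≤v _ x) (⊩⇒∈ φ y))
    ∈⇒⊩ (𝖶 φ) {w} x = not-φ , φ , x , λ z y → ∈⇒⊩ φ (lower y)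
      where
        not-φ : w ⊩ ¬' φ
        not-φ v w≤v y = lift (consistent v (closed-mp v (w≤v _ (mp-WWW w (ax-W φ) x)) (⊩⇒∈ φ y)))

mainTheorem9 : ExcludedMiddle 0ℓ → ∀ (γ : Form) (w : World) → (w ⊩ γ) ⇔ mem w γ
mainTheorem9 lem γ w = mk⇔ (⊩⇒∈ γ) (∈⇒⊩ γ)
  where open TruthLemma lem
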